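{- There is a $3$-partite $3$-graph $\mathcal{H}$ with $\tau(\mathcal{H})=4$ and $\nu(\mathcal{H})=3$ such that $\mathrm{conn}(L(\mathcal{H}))=-1$.
   Context: A $3$-partite $3$-graph has vertex classes $V_1,V_2,V_3$ and a multiset of edges each containing exactly one vertex per class; $\nu,\tau$ are the matching and vertex cover numbers. The line graph $L(\mathcal{H})$ is the simple graph whose vertices are the edges of $\mathcal{H}$, two being adjacent iff they intersect. For a graph $G$, $\mathrm{conn}(G)$ is the largest integer $k$ such that the independence complex of $G$ (the simplicial complex of independent vertex sets of $G$) is topologically $k$-connected, where $(-1)$-connected means nonempty and $0$-connected means nonempty and path-connected. -}

module Defs where

open import Data.Nat using (ℕ; _+_; _≤_; _≥_)
open import Data.Fin using (Fin)
open import Data.Fin.Subset using (Subset; _∈_; ∣_∣; ⁅_⁆; _∪_)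
open import Data.Product using (_×_; Σ; ∃; proj₁; proj₂; _,_)
open import Data.Sum using (_⊎_)
open import Relation.Nullary using (¬_)
open import Relation.Binary.PropositionalEquality using (_≡_; _≢_)

-- Simple graphs on vertex set Fin n, given by an adjacency relation
-- (assumed irreflexive and symmetric where it matters).

record Graph : Set₁ where
  field
    size : ℕ
    Adj  : Fin size → Fin size → Set

open Graph public

-- Independent sets of G = faces of the independence complex of G.
Independent : (G : Graph) → Subset (size G) → Set
Independent G S = ∀ u v → u ∈ S → v ∈ S → ¬ Adj G u v

IndSkeletonEdge : (G : Graph) → Fin (size G) → Fin (size G) → Set
IndSkeletonEdge G u v = u ≢ v × Independent G (⁅ u ⁆ ∪ ⁅ v ⁆)

data Reach {n : ℕ} (E : Fin n → Fin n → Set) : Fin n → Fin n → Set where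
  here : ∀ {u} → Reach E u u
  step : ∀ {u v w} → E u v → Reach E v w → Reach E u w

-- The geometric realization of the independence complex is nonempty
-- ((-1)-connected) iff there is a vertex.
IndComplexNonempty : Graph → Set
IndComplexNonempty G = Fin (size G)

-- The geometric realization is path-connected iff nonempty and its
-- 1-skeleton is connected.
IndComplexPathConnected : Graph → Set
IndComplexPathConnected G =
  IndComplexNonempty G × (∀ u v → Reach (IndSkeletonEdge G) u v)

-- conn(G) = -1 : (-1)-connected but not 0-connected.
ConnIsMinusOne : Graph → Set
ConnIsMinusOne G = IndComplexNonempty G × ¬ IndComplexPathConnected G

-- 3-partite 3-graphs: vertex classes Fin n₁, Fin n₂, Fin n₃, and a
-- multiset of m edges, indexed by Fin m.

record Tripartite3Graph : Set where
  field
    n₁ n₂ n₃ m : ℕ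
    edge : Fin m → Fin n₁ × Fin n₂ × Fin n₃

open Tripartite3Graph public

v₁ v₂ v₃ : (H : Tripartite3Graph) → Fin (m H) → _
v₁ H e = proj₁ (edge H e)
v₂ H e = proj₁ (proj₂ (edge H e))
v₃ H e = proj₂ (proj₂ (edge H e))

Intersect : (H : Tripartite3Graph) → Fin (m H) → Fin (m H) → Set
Intersect H e f = (v₁ H e ≡ v₁ H f) ⊎ (v₂ H e ≡ v₂ H f) ⊎ (v₃ H e ≡ v₃ H f)

LineGraph : Tripartite3Graph → Graph
LineGraph H = record
  { size = m H
  ; Adj  = λ e f → e ≢ f × Intersect H e f }

IsMatching : (H : Tripartite3Graph) → Subset (m H) → Set
IsMatching H S = ∀ e f → e ∈ S → f ∈ S → e ≢ f → ¬ Intersect H e f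

MatchingNumber≡ : Tripartite3Graph → ℕ → Set
MatchingNumber≡ H k =
  (Σ (Subset (m H)) λ S → IsMatching H S × ∣ S ∣ ≡ k)
  × (∀ S → IsMatching H S → ∣ S ∣ ≤ k)

record VertexSet (H : Tripartite3Graph) : Set where
  constructor vset
  field
    C₁ : Subset (n₁ H)
    C₂ : Subset (n₂ H)
    C₃ : Subset (n₃ H)

open VertexSet public

vsize : {H : Tripartite3Graph} → VertexSet H → ℕ
vsize C = ∣ C₁ C ∣ + ∣ C₂ C ∣ + ∣ C₃ C ∣

IsCover : (H : Tripartite3Graph) → VertexSet H → Set
IsCover H C = ∀ e → (v₁ H e ∈ C₁ C) ⊎ (v₂ H e ∈ C₂ C) ⊎ (v₃ H e ∈ C₃ C)

CoverNumber≡ : Tripartite3Graph → ℕ → Set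
CoverNumber≡ H k =
  (Σ (VertexSet H) λ C → IsCover H C × vsize C ≡ k)
  × (∀ C → IsCover H C → vsize C ≥ k)

{-# OPTIONS --safe #-}
module Submission where

-- τ(H) = 4 and ν(H) = 3 are finite statements about the 2¹² vertex sets and
-- 2⁸ edge sets of an 8-edge graph on 4 + 4 + 4 vertices, and are decided by
-- exhaustive search. The 1-skeleton of the independence complex of L(H) is
-- the complement of L(H); in H two disjoint edges meet every other edge, so
-- they form a component of that complement and the complex is disconnected.

open import Defs
open import Data.Fin using (Fin; #_; _≟_)
open import Data.Fin.Properties using (all?)
open import Data.Fin.Subset using (Subset; ∣_∣; ⁅_⁆; _∪_; ⊤; ⊥)
open import Data.Fin.Subset.Properties using (_∈?_; x∈⁅x⁆; x∈p∪q⁺; anySubset?)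
open import Data.Nat using (ℕ; _≤_; _≥_; _≤?_)
open import Data.Product using (Σ; _×_; _,_)
open import Data.Sum using (_⊎_; inj₁; inj₂)
open import Data.Vec using (_∷_; []; lookup)
open import Function using (_∘_)
open import Level using (Level; 0ℓ)
open import Relation.Binary using () renaming (Decidable to Decidable₂)
open import Relation.Binary.PropositionalEquality using (_≡_; refl; subst)
open import Relation.Nullary using (¬_; Dec; ¬?; _⊎-dec_; _→-dec_)
open import Relation.Nullary.Decidable using (map′; from-yes; decidable-stable)
open import Relation.Unary using (Pred; Decidable)

private
  variable
    ℓ : Level
    n : ℕ

allSubsets? : {P : Pred (Subset n) ℓ} → Decidable P → Dec (∀ S → P S)
allSubsets? P? = map′
  (λ ¬∃¬P S → decidable-stable (P? S) (¬∃¬P ∘ (S ,_)))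
  (λ ∀P (S , ¬PS) → ¬PS (∀P S))
  (¬? (anySubset? (¬? ∘ P?)))

module _ (H : Tripartite3Graph) where

  allVertexSets? : {P : Pred (VertexSet H) ℓ} → Decidable P → Dec (∀ C → P C)
  allVertexSets? P? = map′
    (λ ∀P C → ∀P (C₁ C) (C₂ C) (C₃ C))
    (λ ∀P c₁ c₂ c₃ → ∀P (vset c₁ c₂ c₃))
    (allSubsets? λ c₁ → allSubsets? λ c₂ → allSubsets? λ c₃ → P? (vset c₁ c₂ c₃))

  intersect? : Decidable₂ (Intersect H)
  intersect? e f = (v₁ H e ≟ v₁ H f) ⊎-dec (v₂ H e ≟ v₂ H f) ⊎-dec (v₃ H e ≟ v₃ H f)

  isCover? : Decidable (IsCover H)
  isCover? C = all? λ e → (v₁ H e ∈? C₁ C) ⊎-dec (v₂ H e ∈? C₂ C) ⊎-dec (v₃ H e ∈? C₃ C)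

  isMatching? : Decidable (IsMatching H)
  isMatching? S = all? λ e → all? λ f →
    e ∈? S →-dec f ∈? S →-dec ¬? (e ≟ f) →-dec ¬? (intersect? e f)

  coversAtLeast? : ∀ k → Dec (∀ C → IsCover H C → vsize C ≥ k)
  coversAtLeast? k = allVertexSets? λ C → isCover? C →-dec k ≤? vsize C

  matchingsAtMost? : ∀ k → Dec (∀ S → IsMatching H S → ∣ S ∣ ≤ k)
  matchingsAtMost? k = allSubsets? λ S → isMatching? S →-dec ∣ S ∣ ≤? k

Reach-preserves : {E : Fin n → Fin n → Set} {P : Pred (Fin n) ℓ} →
                  (∀ {u v} → E u v → P u → P v) →
                  ∀ {u w} → Reach E u w → P u → P w
Reach-preserves E⇒P here        = λ Pu → Pu
Reach-preserves E⇒P (step e uw) = Reach-preserves E⇒P uw ∘ E⇒P e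

indSkeletonEdge⇒¬Adj : (G : Graph) {u v : Fin (size G)} →
                        IndSkeletonEdge G u v → ¬ Adj G u v
indSkeletonEdge⇒¬Adj G {u} {v} (_ , independent) =
  independent u v (x∈p∪q⁺ (inj₁ (x∈⁅x⁆ u))) (x∈p∪q⁺ (inj₂ (x∈⁅x⁆ v)))

¬indComplexPathConnected : (G : Graph) {P : Pred (Fin (size G)) ℓ} → Decidable P →
                           (∀ {u v} → P u → ¬ P v → Adj G u v) →
                           ∀ {u w} → P u → ¬ P w → ¬ IndComplexPathConnected G
¬indComplexPathConnected G {P} P? crossing⇒Adj {u} {w} Pu ¬Pw (_ , reach) =
  ¬Pw (Reach-preserves preserve (reach u w) Pu)
  where
  preserve : ∀ {x y} → IndSkeletonEdge G x y → P x → P y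
  preserve {y = y} xy Px = decidable-stable (P? y)
    (λ ¬Py → indSkeletonEdge⇒¬Adj G xy (crossing⇒Adj Px ¬Py))

lineGraph-connIsMinusOne : (H : Tripartite3Graph) {P : Pred (Fin (m H)) ℓ} → Decidable P →
                           (∀ {e f} → P e → ¬ P f → Intersect H e f) →
                           ∀ {e f} → P e → ¬ P f → ConnIsMinusOne (LineGraph H)
lineGraph-connIsMinusOne H {P} P? crossing⇒Intersect {e} Pe ¬Pf =
  e , ¬indComplexPathConnected (LineGraph H) P? crossing⇒Adj Pe ¬Pf
  where
  crossing⇒Adj : ∀ {u v} → P u → ¬ P v → Adj (LineGraph H) u v
  crossing⇒Adj Pu ¬Pv = (λ u≡v → ¬Pv (subst P u≡v Pu)) , crossing⇒Intersect Pu ¬Pv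

H₈ : Tripartite3Graph
H₈ = record
  { n₁ = 4 ; n₂ = 4 ; n₃ = 4 ; m = 8
  ; edge = lookup
      ( (# 0 , # 0 , # 0) ∷ (# 2 , # 2 , # 2) ∷ (# 3 , # 1 , # 0) ∷ (# 0 , # 2 , # 1)
      ∷ (# 1 , # 3 , # 2) ∷ (# 1 , # 1 , # 3) ∷ (# 0 , # 1 , # 2) ∷ (# 1 , # 2 , # 0) ∷ [])
  }

Hub : Pred (Fin 8) 0ℓ
Hub e = e ≡ # 6 ⊎ e ≡ # 7

hub? : Decidable Hub
hub? e = (e ≟ # 6) ⊎-dec (e ≟ # 7)

hub-intersects-nonHub : ∀ {e f} → Hub e → ¬ Hub f → Intersect H₈ e f
hub-intersects-nonHub {e} {f} = from-yes
  (all? (λ e → all? (λ f → hub? e →-dec ¬? (hub? f) →-dec intersect? H₈ e f))) e f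

proposition8p2 : Σ Tripartite3Graph λ H →
    CoverNumber≡ H 4 × MatchingNumber≡ H 3 × ConnIsMinusOne (LineGraph H)
proposition8p2 = H₈
  , ((vset ⊤ ⊥ ⊥ , from-yes (isCover? H₈ (vset ⊤ ⊥ ⊥)) , refl) , from-yes (coversAtLeast? H₈ 4))
  , ((matching , from-yes (isMatching? H₈ matching) , refl) , from-yes (matchingsAtMost? H₈ 3))
  , lineGraph-connIsMinusOne H₈ hub? hub-intersects-nonHub {f = # 0} (inj₁ refl) λ { (inj₁ ()) ; (inj₂ ()) }
  where
  matching : Subset 8
  matching = ⁅ # 0 ⁆ ∪ ⁅ # 1 ⁆ ∪ ⁅ # 5 ⁆
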